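{- Let $T$ be the tree on vertex set $\{m,m_1,m_2,m_3,v_1,v_2,v_3\}$ with edges $mm_1,mm_2,mm_3,m_1v_1,m_2v_2,m_3v_3$, with \textbf{positive} vertex weights $\mu:=\mu_T(m)$, $\mu_i':=\mu_T(m_i)$, $\mu_i'':=\mu_T(v_i)$, $i=1,2,3$. Let $T'$ be the vertex-weighted tree obtained from $T$ by replacing edges $mm_3$ and $m_1v_1$ with edges $mv_1$ and $m_1m_3$ (same weights). If $\mu_1'+\mu_1''\le\mu_2'+\mu_2''\le\mu_3'+\mu_3''$, then $VWWI(T)<VWWI(T')$.
   Context: For a vertex-weighted tree $T$ with vertex weights $\mu_T(v)$, $VWWI(T)=\frac12\sum_{u,v\in V(T)}\mu_T(u)\mu_T(v)d_T(u,v)$, where $d_T(u,v)$ is the number of edges on the path between $u$ and $v$.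
   Formalization: The vertex weights $\mu$, $\mu_i'$, $\mu_i''$ are positive rationals rather than positive reals. -}

module Defs where

open import Data.Nat as ℕ using (ℕ; zero; suc)
open import Data.Fin using (Fin; _≟_) renaming (zero to f0; suc to fs)
open import Data.Fin.Base using (toℕ)
open import Data.List using (List; []; _∷_; foldr; map)
open import Data.Bool.ListAction using (any)
open import Data.List.Base using (allFin)
open import Data.Bool using (Bool; true; false; _∨_; _∧_; if_then_else_)
open import Data.Product using (_×_; _,_)
open import Relation.Nullary.Decidable using (⌊_⌋)
open import Data.Rational using (ℚ; 0ℚ; ½; _+_; _*_)
  renaming (_≤_ to _≤ℚ_)
open import Data.Integer using (+_)

EdgeList : ℕ → Set
EdgeList n = List (Fin n × Fin n)

adj : ∀ {n} → EdgeList n → Fin n → Fin n → Bool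
adj [] u v = false
adj ((a , b) ∷ es) u v =
  (⌊ a ≟ u ⌋ ∧ ⌊ b ≟ v ⌋) ∨ (⌊ a ≟ v ⌋ ∧ ⌊ b ≟ u ⌋) ∨ adj es u v

within : ∀ {n} → EdgeList n → ℕ → Fin n → Fin n → Bool
within E zero u v = ⌊ u ≟ v ⌋
within {n} E (suc k) u v =
  within E k u v ∨ any (λ w → adj E u w ∧ within E k w v) (allFin n)

search : ∀ {n} → EdgeList n → Fin n → Fin n → ℕ → ℕ → ℕ
search E u v i zero = i
search E u v i (suc f) = if within E i u v then i else search E u v (suc i) f

-- graph distance d(u,v): number of edges of a shortest path
-- (in a connected graph on n vertices it is < n, so fuel n suffices)
dist : ∀ {n} → EdgeList n → Fin n → Fin n → ℕ
dist {n} E u v = search E u v 0 n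

sumℚ : List ℚ → ℚ
sumℚ = foldr _+_ 0ℚ

ℕtoℚ : ℕ → ℚ
ℕtoℚ k = Data.Rational._/_ (+ k) 1

VWWI : ∀ {n} → EdgeList n → (Fin n → ℚ) → ℚ
VWWI {n} E μ = ½ * sumℚ (map (λ u → sumℚ (map (λ v → μ u * μ v * ℕtoℚ (dist E u v)) (allFin n))) (allFin n))

vm vm₁ vm₂ vm₃ vv₁ vv₂ vv₃ : Fin 7
vm  = f0
vm₁ = fs f0
vm₂ = fs (fs f0)
vm₃ = fs (fs (fs f0))
vv₁ = fs (fs (fs (fs f0)))
vv₂ = fs (fs (fs (fs (fs f0))))
vv₃ = fs (fs (fs (fs (fs (fs f0)))))

T-edges : EdgeList 7
T-edges = (vm , vm₁) ∷ (vm , vm₂) ∷ (vm , vm₃) ∷ (vm₁ , vv₁) ∷ (vm₂ , vv₂) ∷ (vm₃ , vv₃) ∷ []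

T'-edges : EdgeList 7
T'-edges = (vm , vm₁) ∷ (vm , vm₂) ∷ (vm , vv₁) ∷ (vm₁ , vm₃) ∷ (vm₂ , vv₂) ∷ (vm₃ , vv₃) ∷ []

module Submission where

-- The weighted Wiener index of a tree is a sum over its edges:
-- each edge splits the vertices into a side X and its complement, d(u,v)
-- counts the edges whose cut separates u and v, and hence
--   VWWI = Σ_e μ(X_e) μ(V ∖ X_e)   (weighted Wiener edge formula).
--
-- T and T' have the same cut sides on five edges; on the edge m m₁ the side
-- is {m₁,v₁} in T and {m₁,m₃,v₃} in T'.  With a = μ₁', b = μ₁'',
-- c = μ₃'+μ₃'' and d = μ₂'+μ₂''+μ the two indices differ by (c-b)(d-a),
-- and b < c, a < d follow from the hypotheses and positivity of the weights.

open import Defs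
open import Algebra.Bundles using (CommutativeRing)
open import Data.Bool using (Bool; true; false; not; _xor_; if_then_else_)
open import Data.Bool.ListAction using (any)
open import Data.Fin using (Fin) renaming (zero to f0; suc to fs; _≟_ to _≟ᶠ_)
open import Data.Fin.Properties using (all?)
open import Data.List using (List; []; _∷_; map; allFin; tabulate)
open import Data.List.Properties using (map-tabulate)
open import Data.Maybe using (Maybe; just; nothing)
open import Data.Nat using (zero; suc)
open import Data.Rational
  using (ℚ; Positive; positive; _+_; _*_; _-_; -_; _≤_; _<_; 0ℚ; 1ℚ; ½; _≟_)
import Data.Rational.Properties as ℚP
open import Function using (id; _∘_)
open import Relation.Binary.PropositionalEquality
open import Relation.Nullary using (yes; no)
open import Relation.Nullary.Decidable using (from-yes; ⌊_⌋)
open import Tactic.RingSolver using (solve-∀)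
open import Tactic.RingSolver.Core.AlmostCommutativeRing
  using (AlmostCommutativeRing; fromCommutativeRing)
open import Algebra.Properties.Semiring.Sum
  (CommutativeRing.semiring ℚP.+-*-commutativeRing)
  using (sum-syntax; sum-cong-≗; ∑-distrib-+; ∑-comm; *-distribˡ-sum; *-distribʳ-sum)

ℚ-ring : AlmostCommutativeRing _ _
ℚ-ring = fromCommutativeRing ℚP.+-*-commutativeRing zero?
  where
  zero? : (x : ℚ) → Maybe (0ℚ ≡ x)
  zero? x with 0ℚ ≟ x
  ... | yes p = just p
  ... | no _ = nothing

pairSum : ∀ {n} → (Fin n → ℚ) → (Fin n → Fin n → ℚ) → ℚ
pairSum {n} μ D = ∑[ u < n ] ∑[ v < n ] (μ u * μ v * D u v)

sumℚ-allFin : ∀ {n} (f : Fin n → ℚ) → sumℚ (map f (allFin n)) ≡ ∑[ i < n ] f i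
sumℚ-allFin f = trans (cong sumℚ (map-tabulate id f)) (sumℚ-tabulate f)
  where
  sumℚ-tabulate : ∀ {n} (g : Fin n → ℚ) → sumℚ (tabulate g) ≡ ∑[ i < n ] g i
  sumℚ-tabulate {zero} g = refl
  sumℚ-tabulate {suc n} g = cong (g f0 +_) (sumℚ-tabulate (g ∘ fs))

VWWI-pairSum : ∀ {n} (E : EdgeList n) (μ : Fin n → ℚ) →
  VWWI E μ ≡ ½ * pairSum μ (λ u v → ℕtoℚ (dist E u v))
VWWI-pairSum {n} E μ = cong (½ *_) (trans
  (sumℚ-allFin (λ u → sumℚ (map (λ v → μ u * μ v * ℕtoℚ (dist E u v)) (allFin n))))
  (sum-cong-≗ (λ u → sumℚ-allFin (λ v → μ u * μ v * ℕtoℚ (dist E u v)))))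

pairSum-cong : ∀ {n} (μ : Fin n → ℚ) {D D′ : Fin n → Fin n → ℚ} →
  (∀ u v → D u v ≡ D′ u v) → pairSum μ D ≡ pairSum μ D′
pairSum-cong μ D≡D′ =
  sum-cong-≗ λ u → sum-cong-≗ λ v → cong (μ u * μ v *_) (D≡D′ u v)

pairSum-+ : ∀ {n} (μ : Fin n → ℚ) (D D′ : Fin n → Fin n → ℚ) →
  pairSum μ (λ u v → D u v + D′ u v) ≡ pairSum μ D + pairSum μ D′
pairSum-+ {n} μ D D′ = begin
  pairSum μ (λ u v → D u v + D′ u v)
    ≡⟨ sum-cong-≗ (λ u → sum-cong-≗ λ v → ℚP.*-distribˡ-+ (μ u * μ v) (D u v) (D′ u v)) ⟩
  ∑[ u < n ] ∑[ v < n ] (μ u * μ v * D u v + μ u * μ v * D′ u v)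
    ≡⟨ sum-cong-≗ (λ u → ∑-distrib-+ (λ v → μ u * μ v * D u v) (λ v → μ u * μ v * D′ u v)) ⟩
  ∑[ u < n ] (∑[ v < n ] (μ u * μ v * D u v) + ∑[ v < n ] (μ u * μ v * D′ u v))
    ≡⟨ ∑-distrib-+ (λ u → ∑[ v < n ] (μ u * μ v * D u v)) (λ u → ∑[ v < n ] (μ u * μ v * D′ u v)) ⟩
  pairSum μ D + pairSum μ D′ ∎
  where open ≡-Reasoning

pairSum-∑ : ∀ {n k} (μ : Fin n → ℚ) (F : Fin k → Fin n → Fin n → ℚ) →
  pairSum μ (λ u v → ∑[ e < k ] F e u v) ≡ ∑[ e < k ] pairSum μ (F e)
pairSum-∑ {n} {k} μ F = begin
  pairSum μ (λ u v → ∑[ e < k ] F e u v)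
    ≡⟨ sum-cong-≗ (λ u → sum-cong-≗ λ v → *-distribˡ-sum (μ u * μ v) (λ e → F e u v)) ⟩
  ∑[ u < n ] ∑[ v < n ] ∑[ e < k ] (μ u * μ v * F e u v)
    ≡⟨ sum-cong-≗ (λ u → ∑-comm (λ v e → μ u * μ v * F e u v)) ⟩
  ∑[ u < n ] ∑[ e < k ] ∑[ v < n ] (μ u * μ v * F e u v)
    ≡⟨ ∑-comm (λ u e → ∑[ v < n ] (μ u * μ v * F e u v)) ⟩
  ∑[ e < k ] pairSum μ (F e) ∎
  where open ≡-Reasoning

pairSum-product : ∀ {n} (μ f g : Fin n → ℚ) →
  pairSum μ (λ u v → f u * g v) ≡ (∑[ u < n ] (μ u * f u)) * (∑[ v < n ] (μ v * g v))
pairSum-product {n} μ f g = begin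
  pairSum μ (λ u v → f u * g v)
    ≡⟨ sum-cong-≗ (λ u → sum-cong-≗ λ v → interchange (μ u) (μ v) (f u) (g v)) ⟩
  ∑[ u < n ] ∑[ v < n ] (μ u * f u * (μ v * g v))
    ≡⟨ sum-cong-≗ (λ u → sym (*-distribˡ-sum (μ u * f u) (λ v → μ v * g v))) ⟩
  ∑[ u < n ] (μ u * f u * ∑[ v < n ] (μ v * g v))
    ≡⟨ sym (*-distribʳ-sum (∑[ v < n ] (μ v * g v)) (λ u → μ u * f u)) ⟩
  (∑[ u < n ] (μ u * f u)) * (∑[ v < n ] (μ v * g v)) ∎
  where
  open ≡-Reasoning
  interchange : ∀ a b c d → a * b * (c * d) ≡ a * c * (b * d)
  interchange = solve-∀ ℚ-ring

χ : Bool → ℚ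
χ true = 1ℚ
χ false = 0ℚ

mass : ∀ {n} → (Fin n → Bool) → (Fin n → ℚ) → ℚ
mass {n} X μ = ∑[ u < n ] (μ u * χ (X u))

co : ∀ {n} → (Fin n → Bool) → Fin n → Bool
co X u = not (X u)

cutProduct : ∀ {n} → (Fin n → Bool) → (Fin n → ℚ) → ℚ
cutProduct X μ = mass X μ * mass (co X) μ

sep : ∀ {n} → (Fin n → Bool) → Fin n → Fin n → ℚ
sep X u v = χ (X u xor X v)

χ-xor : ∀ x y → χ (x xor y) ≡ χ x * χ (not y) + χ (not x) * χ y
χ-xor true true = refl
χ-xor true false = refl
χ-xor false true = refl
χ-xor false false = refl

cut-pairSum : ∀ {n} (μ : Fin n → ℚ) (X : Fin n → Bool) →
  ½ * pairSum μ (sep X) ≡ cutProduct X μ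
cut-pairSum μ X = begin
  ½ * pairSum μ (sep X)
    ≡⟨ cong (½ *_) (pairSum-cong μ (λ u v → χ-xor (X u) (X v))) ⟩
  ½ * pairSum μ (λ u v → f u * g v + g u * f v)
    ≡⟨ cong (½ *_) (pairSum-+ μ (λ u v → f u * g v) (λ u v → g u * f v)) ⟩
  ½ * (pairSum μ (λ u v → f u * g v) + pairSum μ (λ u v → g u * f v))
    ≡⟨ cong (½ *_) (cong₂ _+_ (pairSum-product μ f g) (pairSum-product μ g f)) ⟩
  ½ * (mass X μ * mass (co X) μ + mass (co X) μ * mass X μ)
    ≡⟨ half-symmetric (mass X μ) (mass (co X) μ) ⟩
  mass X μ * mass (co X) μ ∎
  where
  open ≡-Reasoning
  f g : _ → ℚ
  f u = χ (X u)
  g u = χ (not (X u))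
  half-symmetric : ∀ p q → ½ * (p * q + q * p) ≡ p * q
  half-symmetric = solve-∀ ℚ-ring

VWWI-cuts : ∀ {n k} (E : EdgeList n) (cut : Fin k → Fin n → Bool) →
  (∀ u v → ℕtoℚ (dist E u v) ≡ ∑[ e < k ] sep (cut e) u v) →
  (μ : Fin n → ℚ) → VWWI E μ ≡ ∑[ e < k ] cutProduct (cut e) μ
VWWI-cuts {n} {k} E cut dist≡cuts μ = begin
  VWWI E μ
    ≡⟨ VWWI-pairSum E μ ⟩
  ½ * pairSum μ (λ u v → ℕtoℚ (dist E u v))
    ≡⟨ cong (½ *_) (pairSum-cong μ dist≡cuts) ⟩
  ½ * pairSum μ (λ u v → ∑[ e < k ] sep (cut e) u v)
    ≡⟨ cong (½ *_) (pairSum-∑ μ (λ e → sep (cut e))) ⟩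
  ½ * ∑[ e < k ] pairSum μ (sep (cut e))
    ≡⟨ *-distribˡ-sum ½ (λ e → pairSum μ (sep (cut e))) ⟩
  ∑[ e < k ] (½ * pairSum μ (sep (cut e)))
    ≡⟨ sum-cong-≗ (λ e → cut-pairSum μ (cut e)) ⟩
  ∑[ e < k ] cutProduct (cut e) μ ∎
  where open ≡-Reasoning

selected : ∀ {n} → (Fin n → Bool) → (Fin n → ℚ) → List ℚ
selected {zero} X μ = []
selected {suc n} X μ =
  if X f0 then μ f0 ∷ selected (X ∘ fs) (μ ∘ fs) else selected (X ∘ fs) (μ ∘ fs)

-- The mass of X is the plain sum of its selected weights; for a concrete
-- set this computes to a sum of weights without indicator factors.
mass-selected : ∀ {n} (X : Fin n → Bool) (μ : Fin n → ℚ) → mass X μ ≡ sumℚ (selected X μ)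
mass-selected {zero} X μ = refl
mass-selected {suc n} X μ with X f0
... | true = cong₂ _+_ (ℚP.*-identityʳ (μ f0)) (mass-selected (X ∘ fs) (μ ∘ fs))
... | false = begin
  μ f0 * 0ℚ + mass (X ∘ fs) (μ ∘ fs) ≡⟨ cong (_+ mass (X ∘ fs) (μ ∘ fs)) (ℚP.*-zeroʳ (μ f0)) ⟩
  0ℚ + mass (X ∘ fs) (μ ∘ fs)        ≡⟨ ℚP.+-identityˡ _ ⟩
  mass (X ∘ fs) (μ ∘ fs)             ≡⟨ mass-selected (X ∘ fs) (μ ∘ fs) ⟩
  sumℚ (selected (X ∘ fs) (μ ∘ fs))  ∎
  where open ≡-Reasoning

<⇒positive-difference : ∀ {p q} → p < q → Positive (q - p)
<⇒positive-difference {p} {q} p<q =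
  positive (subst (_< q - p) (ℚP.+-inverseʳ p) (ℚP.+-monoˡ-< (- p) p<q))

<-+-positive : ∀ x r → Positive r → x < x + r
<-+-positive x r r>0 =
  subst (_< x + r) (ℚP.+-identityʳ x) (ℚP.+-monoʳ-< x (ℚP.positive⁻¹ r {{r>0}}))

-- Exchanging b and c between the two sides of a split (a+b | c+d) changes
-- the product of the sides by (c - b)(d - a); so it strictly increases the
-- product when b < c and a < d.
swap-gain : ∀ {a b c d} → b < c → a < d → (a + b) * (c + d) < (a + c) * (b + d)
swap-gain {a} {b} {c} {d} b<c a<d =
  subst ((a + b) * (c + d) <_) (sym (exchange a b c d))
    (<-+-positive _ _ (ℚP.pos*pos⇒pos (c - b) {{<⇒positive-difference b<c}}
                                      (d - a) {{<⇒positive-difference a<d}}))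
  where
  exchange : ∀ a b c d → (a + c) * (b + d) ≡ (a + b) * (c + d) + (c - b) * (d - a)
  exchange = solve-∀ ℚ-ring

side : ∀ {n} → List (Fin n) → Fin n → Bool
side S u = any (λ w → ⌊ w ≟ᶠ u ⌋) S

-- Sides of the five edges that T and T' share up to relabelling: m m₂,
-- m₁ v₁ (resp. m v₁), m m₃ (resp. m₁ m₃), m₂ v₂ and m₃ v₃.
shared-cuts : Fin 5 → Fin 7 → Bool
shared-cuts f0 = side (vm₂ ∷ vv₂ ∷ [])
shared-cuts (fs f0) = side (vv₁ ∷ [])
shared-cuts (fs (fs f0)) = side (vm₃ ∷ vv₃ ∷ [])
shared-cuts (fs (fs (fs f0))) = side (vv₂ ∷ [])
shared-cuts (fs (fs (fs (fs f0)))) = side (vv₃ ∷ [])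

-- The side of the edge m m₁ in T and in T' respectively.
X₁ X₁′ : Fin 7 → Bool
X₁ = side (vm₁ ∷ vv₁ ∷ [])
X₁′ = side (vm₁ ∷ vm₃ ∷ vv₃ ∷ [])

T-cuts T′-cuts : Fin 6 → Fin 7 → Bool
T-cuts f0 = X₁
T-cuts (fs e) = shared-cuts e
T′-cuts f0 = X₁′
T′-cuts (fs e) = shared-cuts e

T-dist : ∀ u v → ℕtoℚ (dist T-edges u v) ≡ ∑[ e < 6 ] sep (T-cuts e) u v
T-dist = from-yes (all? λ u → all? λ v →
  ℕtoℚ (dist T-edges u v) ≟ ∑[ e < 6 ] sep (T-cuts e) u v)

T′-dist : ∀ u v → ℕtoℚ (dist T'-edges u v) ≡ ∑[ e < 6 ] sep (T′-cuts e) u v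
T′-dist = from-yes (all? λ u → all? λ v →
  ℕtoℚ (dist T'-edges u v) ≟ ∑[ e < 6 ] sep (T′-cuts e) u v)

edge-swap : (μ : Fin 7 → ℚ) → (∀ x → Positive (μ x)) →
  μ vm₁ + μ vv₁ ≤ μ vm₂ + μ vv₂ →
  μ vm₂ + μ vv₂ ≤ μ vm₃ + μ vv₃ →
  cutProduct X₁ μ < cutProduct X₁′ μ
edge-swap μ pos h12 h23 = subst₂ _<_ (sym T-side) (sym T′-side) (swap-gain b₁<c a₁<d)
  where
  open ℚP.≤-Reasoning
  m = μ vm
  a₁ = μ vm₁
  a₂ = μ vm₂
  a₃ = μ vm₃
  b₁ = μ vv₁
  b₂ = μ vv₂
  b₃ = μ vv₃
  -- a₁ and b₁ swap sides, with the branches c = a₃ + b₃ and d = a₂ + b₂ + m.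
  T-side : cutProduct X₁ μ ≡ (a₁ + b₁) * ((a₃ + b₃) + (a₂ + b₂ + m))
  T-side = trans (cong₂ _*_ (mass-selected X₁ μ) (mass-selected (co X₁) μ))
                 (regroup m a₁ a₂ a₃ b₁ b₂ b₃)
    where
    regroup : ∀ m a₁ a₂ a₃ b₁ b₂ b₃ →
      (a₁ + (b₁ + 0ℚ)) * (m + (a₂ + (a₃ + (b₂ + (b₃ + 0ℚ))))) ≡
      (a₁ + b₁) * ((a₃ + b₃) + (a₂ + b₂ + m))
    regroup = solve-∀ ℚ-ring
  T′-side : cutProduct X₁′ μ ≡ (a₁ + (a₃ + b₃)) * (b₁ + (a₂ + b₂ + m))
  T′-side = trans (cong₂ _*_ (mass-selected X₁′ μ) (mass-selected (co X₁′) μ))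
                  (regroup m a₁ a₂ a₃ b₁ b₂ b₃)
    where
    regroup : ∀ m a₁ a₂ a₃ b₁ b₂ b₃ →
      (a₁ + (a₃ + (b₃ + 0ℚ))) * (m + (a₂ + (b₁ + (b₂ + 0ℚ)))) ≡
      (a₁ + (a₃ + b₃)) * (b₁ + (a₂ + b₂ + m))
    regroup = solve-∀ ℚ-ring
  b₁<c : b₁ < a₃ + b₃
  b₁<c = begin-strict
    b₁      <⟨ <-+-positive b₁ a₁ (pos vm₁) ⟩
    b₁ + a₁ ≡⟨ ℚP.+-comm b₁ a₁ ⟩
    a₁ + b₁ ≤⟨ h12 ⟩
    a₂ + b₂ ≤⟨ h23 ⟩
    a₃ + b₃ ∎
  a₁<d : a₁ < a₂ + b₂ + m
  a₁<d = begin-strict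
    a₁          <⟨ <-+-positive a₁ b₁ (pos vv₁) ⟩
    a₁ + b₁     ≤⟨ h12 ⟩
    a₂ + b₂     <⟨ <-+-positive (a₂ + b₂) m (pos vm) ⟩
    a₂ + b₂ + m ∎

lemma1 : (μ : Fin 7 → ℚ) → (∀ x → Positive (μ x)) →
    μ vm₁ + μ vv₁ ≤ μ vm₂ + μ vv₂ →
    μ vm₂ + μ vv₂ ≤ μ vm₃ + μ vv₃ →
    VWWI T-edges μ < VWWI T'-edges μ
lemma1 μ pos h12 h23 = begin-strict
  VWWI T-edges μ                  ≡⟨ VWWI-cuts T-edges T-cuts T-dist μ ⟩
  cutProduct X₁ μ + shared        <⟨ ℚP.+-monoˡ-< shared (edge-swap μ pos h12 h23) ⟩
  cutProduct X₁′ μ + shared       ≡⟨ sym (VWWI-cuts T'-edges T′-cuts T′-dist μ) ⟩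
  VWWI T'-edges μ                 ∎
  where
  open ℚP.≤-Reasoning
  shared : ℚ
  shared = ∑[ e < 5 ] cutProduct (shared-cuts e) μ
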